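{- Let $q$ be an odd prime power and let $\chi$ be the modified algebraic coloring of the complete graph on $\mathbb{F}_q^2$ defined in the context. If $a,b,c\in\mathbb{F}_q^2$ are distinct with $\chi(ab)=\chi(ac)$, then $b_1\ne c_1$.
   Context: Vertices are vectors $x=(x_1,x_2)\in\mathbb{F}_q^2$. For distinct $x,y$ let $\chi_1(xy)=(x_1y_1-x_2-y_2,\ \delta(x_1,y_1))$ with $\delta(x_1,y_1)=0$ if $x_1=y_1$ and $1$ otherwise (field operations in $\mathbb{F}_q$). For $\alpha\in\mathbb{F}_q$, the graph $G_\alpha$ on $\mathbb{F}_q\setminus\{\alpha\}$ with edges $\{x,y\}$, $x+y=2\alpha$, is a perfect matching; fix a partition $\mathbb{F}_q\setminus\{\alpha\}=S_\alpha\cup T_\alpha$ with each matching edge having one endpoint in each part, and for $\beta\ne\alpha$ let $f_\alpha(\beta)=S$ if $\beta\in S_\alpha$ and $T$ if $\beta\in T_\alpha$. Fix a linear order $<$ on $\mathbb{F}_q^2$. For $x<y$ with $x_1\ne y_1$ let $\chi_2(xy)=(f_{x_1}(y_1),f_{y_1}(x_1))$; when $x_1=y_1$, $\chi_2(xy)$ is some fixed value. Then $\chi(xy)=(\chi_1(xy),\chi_2(xy))$. -}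

module Defs where

open import Level using (0ℓ)
open import Data.Nat using (ℕ; suc; _^_)
open import Data.Nat.Primality using (Prime)
open import Data.Fin using (Fin)
open import Data.Bool using (Bool; true; false)
open import Data.Product using (_×_; _,_; proj₁; proj₂; ∃; ∃-syntax)
open import Relation.Nullary using (yes; no)
open import Relation.Binary using (IsStrictTotalOrder; Rel; tri<; tri≈; tri>)
open import Relation.Binary.PropositionalEquality using (_≡_; _≢_)
open import Relation.Binary.Definitions using (DecidableEquality)
open import Algebra.Structures using (IsCommutativeRing)
open import Function.Bundles using (_↔_)

IsPrimePower : ℕ → Set
IsPrimePower q = ∃[ p ] ∃[ k ] (Prime p × q ≡ p ^ suc k)

record FiniteField (q : ℕ) : Set₁ where
  infixl 7 _*_
  infixl 6 _+_ _-_
  field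
    F        : Set
    _+_ _*_  : F → F → F
    -_       : F → F
    0# 1#    : F
    isCommutativeRing : IsCommutativeRing _≡_ _+_ _*_ -_ 0# 1#
    _≟_      : DecidableEquality F
    0≢1      : 0# ≢ 1#
    inverse  : ∀ x → x ≢ 0# → ∃[ y ] (x * y ≡ 1#)
    enum     : F ↔ Fin q

  _-_ : F → F → F
  x - y = x + (- y)

  V : Set
  V = F × F

data Side : Set where
  S T : Side

-- The data fixed in the construction of χ₂:
--  * side α β = f_α(β) : for β ≠ α, which part (S_α or T_α) β lies in;
--    each matching edge {β, 2α - β} of G_α has one endpoint in each part.
--    (The value side α α is irrelevant and never used.)
--  * a linear (strict total) order on F_q^2;
--  * the fixed value of χ₂ on pairs with x₁ = y₁.
record ColoringData {q : ℕ} (K : FiniteField q) : Set₁ where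
  open FiniteField K
  field
    side     : F → F → Side
    matching : ∀ α β → β ≢ α → side α β ≢ side α ((α + α) - β)
    _≺_      : Rel V 0ℓ
    isSTO    : IsStrictTotalOrder _≡_ _≺_
    fixed₂   : Side × Side

module Coloring {q : ℕ} (K : FiniteField q) (D : ColoringData K) where
  open FiniteField K
  open ColoringData D
  open IsStrictTotalOrder isSTO using (compare)

  δ : F → F → Bool
  δ x y with x ≟ y
  ... | yes _ = false
  ... | no  _ = true

  χ₁ : V → V → F × Bool
  χ₁ (x₁ , x₂) (y₁ , y₂) = ((x₁ * y₁ - x₂) - y₂ , δ x₁ y₁)

  χ₂ : V → V → Side × Side
  χ₂ x y with proj₁ x ≟ proj₁ y
  ... | yes _ = fixed₂
  ... | no  _ with compare x y
  ...   | tri< _ _ _ = (side (proj₁ x) (proj₁ y) , side (proj₁ y) (proj₁ x))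
  ...   | tri≈ _ _ _ = fixed₂   -- x = y: not an edge, unused
  ...   | tri> _ _ _ = (side (proj₁ y) (proj₁ x) , side (proj₁ x) (proj₁ y))

  χ : V → V → (F × Bool) × (Side × Side)
  χ x y = (χ₁ x y , χ₂ x y)

-- The first coordinate of χ₁(a x) is a₁ x₁ − a₂ − x₂, which for fixed a and x₁ is an injective
-- function of x₂.  So if b₁ = c₁, equal colours force b₂ = c₂, i.e. b = c.
module Submission where

open import Defs
open import Data.Nat using (ℕ)
open import Data.Nat.DivMod using (_%_)
open import Data.Product using (proj₁; _,_)
open import Data.Product.Properties using (×-≡,≡→≡)
open import Relation.Binary.PropositionalEquality using (_≡_; _≢_; cong; subst)
open import Algebra.Bundles using (CommutativeRing)
import Algebra.Properties.Group as GroupProperties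

module _ {q : ℕ} (K : FiniteField q) where
  open FiniteField K

  ring : CommutativeRing _ _
  ring = record { isCommutativeRing = isCommutativeRing }

  open GroupProperties (CommutativeRing.+-group ring) using (∙-cancelˡ; ⁻¹-injective)

  -‿cancelˡ : ∀ x y z → x - y ≡ x - z → y ≡ z
  -‿cancelˡ x y z eq = ⁻¹-injective (∙-cancelˡ x (- y) (- z) eq)

module _ {q : ℕ} (K : FiniteField q) (D : ColoringData K) where
  open FiniteField K
  open Coloring K D

  χ₁-injective-on-vertical-line : ∀ a b c → proj₁ b ≡ proj₁ c → χ₁ a b ≡ χ₁ a c → b ≡ c
  χ₁-injective-on-vertical-line (a₁ , a₂) (b₁ , b₂) (c₁ , c₂) b₁≡c₁ eq =
    ×-≡,≡→≡ (b₁≡c₁ , -‿cancelˡ K ((a₁ * c₁) - a₂) b₂ c₂ same-base)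
    where
    same-base : (a₁ * c₁ - a₂) - b₂ ≡ (a₁ * c₁ - a₂) - c₂
    same-base = subst (λ t → (a₁ * t - a₂) - b₂ ≡ (a₁ * c₁ - a₂) - c₂) b₁≡c₁ (cong proj₁ eq)

lemma11 : (q : ℕ) → IsPrimePower q → q % 2 ≡ 1 → (K : FiniteField q) → (D : ColoringData K) →
          ∀ (a b c : FiniteField.V K) → a ≢ b → a ≢ c → b ≢ c →
          Coloring.χ K D a b ≡ Coloring.χ K D a c → proj₁ b ≢ proj₁ c
lemma11 q _ _ K D a b c _ _ b≢c χab≡χac b₁≡c₁ =
  b≢c (χ₁-injective-on-vertical-line K D a b c b₁≡c₁ (cong proj₁ χab≡χac))
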